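{- Let $n,d\ge1$ and $k\ge2$ be natural numbers, and put $p=p_{n,d}=\left\lceil \tfrac32 (n+1)d(\log_3(nd)+2)\right\rceil$. Let $S=(w_1,\dots,w_N)$ be a finite sequence of words of length $k-1$ over the alphabet $\{0,1\}$, each consisting of $k-2$ symbols $0$ and exactly one symbol $1$. Suppose $S$ satisfies: whenever for some position $s\in\{1,\dots,k-1\}$ there are indices $j_1<j_2<\dots<j_p$ such that each $w_{j_i}$ has its $1$ at position $s$, there is an index $j$ with $j_1<j<j_p$ such that $w_j$ has its $1$ at a position strictly less than $s$. Then $N\le p^{k-1}-1$. -}

module Defs where

open import Data.Nat using (ℕ; _+_; _*_; _∸_; _^_; _≤_)
open import Data.Product using (_×_)
open import Data.Fin using (Fin)
import Data.Fin
open import Data.Vec using (Vec; lookup)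
open import Data.Empty using (⊥)
open import Relation.Binary.PropositionalEquality using (_≡_)
open import Relation.Nullary using (¬_)
open import Data.Product using (∃)

-- For integers m and x = (3/2)(n+1)d(log₃(nd)+2),
-- with A = 3(n+1)d and n,d ≥ 1:
--   m ≥ x  ⇔  2m/A - 2 ≥ log₃(nd)  ⇔  m ≥ A  ∧  (nd)^A ≤ 9^(m - A).
-- (If m < A the exponent 2m/A - 2 is negative, so 3^(…) < 1 ≤ nd.)
-- AbovePnd n d m  :  the natural number m is ≥ x.
AbovePnd : ℕ → ℕ → ℕ → Set
AbovePnd n d m = (3 * (n + 1) * d ≤ m) × ((n * d) ^ (3 * (n + 1) * d) ≤ 9 ^ (m ∸ 3 * (n + 1) * d))

IsPnd : ℕ → ℕ → ℕ → Set
IsPnd n d p = AbovePnd n d p × (∀ m → AbovePnd n d m → p ≤ m)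

Word : ℕ → Set
Word L = Vec (Fin 2) L

OneAt : ∀ {L} → Word L → Fin L → Set
OneAt w s = lookup w s ≡ Data.Fin.suc Data.Fin.zero

ExactlyOneOne : ∀ {L} → Word L → Set
ExactlyOneOne {L} w = ∃ λ s → OneAt w s × (∀ t → ¬ (t ≡ s) → lookup w t ≡ Data.Fin.zero)

{-# OPTIONS --safe #-}
-- Call the position of the 1 in a word its level.  By
-- induction on L: a stretch of the sequence whose levels lie in a band [m, m + L) has
-- length < p ^ L.  Indeed, cut a stretch of length p ^ (L + 1) into p blocks of length
-- p ^ L; by induction each block contains level m, and these p occurrences of level m
-- would have to be separated by some level < m, which does not occur in the stretch.
module Submission where

open import Defs
open import Data.Nat using (ℕ; zero; suc; _+_; _*_; _∸_; _^_; _≤_; _<_; z≤n; s≤s; z<s; _≤?_)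
open import Data.Nat.Properties
open import Data.Fin using (Fin; toℕ; fromℕ<)
import Data.Fin as F
open import Data.Fin.Properties using (any?; toℕ<n; toℕ-fromℕ<; toℕ-injective)
open import Data.Product using (_×_; ∃; _,_; proj₁; proj₂)
open import Data.Empty using (⊥-elim)
open import Level using (Level)
open import Relation.Nullary using (¬_; yes; no)
open import Relation.Nullary.Decidable using (_×-dec_)
open import Relation.Unary using (Pred; Decidable)
open import Relation.Binary.PropositionalEquality using (_≡_; sym; trans; cong; subst)

module _ {ℓ : Level} {N : ℕ} {P : Pred (Fin N) ℓ} (P? : Decidable P) where

  witnessOr : Fin N → Fin N
  witnessOr default with any? P?
  ... | yes (j , _) = j
  ... | no _        = default

  witnessOr-satisfies : ∀ default → ∃ P → P (witnessOr default)
  witnessOr-satisfies default (j , Pj) with any? P?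
  ... | yes (_ , Pw) = Pw
  ... | no none      = ⊥-elim (none (j , Pj))

oneAt-unique : ∀ {L} {w : Word L} (one : ExactlyOneOne w) {t} → OneAt w t → t ≡ proj₁ one
oneAt-unique (s , _ , zeroElsewhere) {t} oneAtT with t F.≟ s
... | yes t≡s = t≡s
... | no t≢s  with trans (sym (zeroElsewhere t t≢s)) oneAtT
...   | ()

pnd-positive : ∀ {n d p} → 1 ≤ n → 1 ≤ d → IsPnd n d p → 1 ≤ p
pnd-positive {suc n} {suc d} {suc p} _ _ _ = s≤s z≤n

Increasing : ∀ {N} → ℕ → (ℕ → Fin N) → Set
Increasing p js = ∀ i i′ → i < i′ → i′ < p → js i F.< js i′

RunsInterrupted : ∀ {N} → (Fin N → ℕ) → ℕ → Set
RunsInterrupted {N} level p =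
  ∀ m (js : ℕ → Fin N) → Increasing p js →
  (∀ i → i < p → level (js i) ≡ m) →
  ∃ λ j → (js 0 F.< j) × (j F.< js (p ∸ 1)) × (level j < m)

module Interrupted {N p : ℕ} (level : Fin N → ℕ) (p≥1 : 1 ≤ p)
                   (interrupted : RunsInterrupted level p) where

  InInterval : ℕ → ℕ → Fin N → Set
  InInterval a b j = a ≤ toℕ j × toℕ j < b

  LevelsWithin : ℕ → ℕ → ℕ → ℕ → Set
  LevelsWithin L m a b = ∀ j → InInterval a b j → m ≤ level j × level j < m + L

  LevelsWithin-⊆ : ∀ {L m a b a′ b′} → a ≤ a′ → b′ ≤ b →
                   LevelsWithin L m a b → LevelsWithin L m a′ b′
  LevelsWithin-⊆ a≤a′ b′≤b within j (a′≤j , j<b′) =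
    within j (≤-trans a≤a′ a′≤j , <-≤-trans j<b′ b′≤b)

  HasLevelIn : ℕ → ℕ → ℕ → Fin N → Set
  HasLevelIn m a b j = InInterval a b j × level j ≡ m

  hasLevelIn? : ∀ m a b → Decidable (HasLevelIn m a b)
  hasLevelIn? m a b j = ((a ≤? toℕ j) ×-dec (suc (toℕ j) ≤? b)) ×-dec (level j ≟ m)

  NoLongInterval : ℕ → Set
  NoLongInterval L = ∀ {m a b} → LevelsWithin L m a b → b ≤ N → ¬ (a + p ^ L ≤ b)

  lowest-level-occurs : ∀ {L m a} → NoLongInterval L →
                        LevelsWithin (suc L) m a (a + p ^ L) → a + p ^ L ≤ N →
                        ∃ (HasLevelIn m a (a + p ^ L))
  lowest-level-occurs {L} {m} {a} noLong within bound
    with any? (hasLevelIn? m a (a + p ^ L))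
  ... | yes found = found
  ... | no none   = ⊥-elim (noLong raised bound ≤-refl)
    where
    raised : LevelsWithin L (suc m) a (a + p ^ L)
    raised j j∈ = let m≤ , <m+1+L = within j j∈ in
      ≤∧≢⇒< m≤ (λ m≡ → none (j , j∈ , sym m≡)) , subst (level j <_) (+-suc m L) <m+1+L

  long-run : ∀ {L m a b} → NoLongInterval L → LevelsWithin (suc L) m a b → b ≤ N →
             a + p ^ suc L ≤ b →
             ∃ λ js → Increasing p js × (∀ i → i < p → HasLevelIn m a b (js i))
  long-run {L} {m} {a} {b} noLong within b≤N long = js , js-increasing , js-in-interval
    where
    q : ℕ
    q = p ^ L

    start : ℕ → ℕ
    start i = a + i * q

    block-end≤start : ∀ {i i′} → i < i′ → start i + q ≤ start i′
    block-end≤start {i} {i′} i<i′ = begin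
      a + i * q + q    ≡⟨ +-assoc a (i * q) q ⟩
      a + (i * q + q)  ≡⟨ cong (a +_) (+-comm (i * q) q) ⟩
      a + suc i * q    ≤⟨ +-monoʳ-≤ a (*-monoˡ-≤ q i<i′) ⟩
      a + i′ * q       ∎
      where open ≤-Reasoning

    block-end≤b : ∀ {i} → i < p → start i + q ≤ b
    block-end≤b i<p = ≤-trans (block-end≤start i<p) long

    block-has-level : ∀ {i} → i < p → ∃ (HasLevelIn m (start i) (start i + q))
    block-has-level {i} i<p =
      lowest-level-occurs noLong
        (LevelsWithin-⊆ (m≤m+n a (i * q)) (block-end≤b i<p) within)
        (≤-trans (block-end≤b i<p) b≤N)

    -- Only the values below p matter; the default merely makes js total.
    js : ℕ → Fin N
    js i = witnessOr (hasLevelIn? m (start i) (start i + q)) (proj₁ (block-has-level p≥1))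

    js-in-block : ∀ {i} → i < p → HasLevelIn m (start i) (start i + q) (js i)
    js-in-block i<p = witnessOr-satisfies _ _ (block-has-level i<p)

    js-increasing : Increasing p js
    js-increasing i i′ i<i′ i′<p =
      <-≤-trans (proj₂ (proj₁ (js-in-block (<-trans i<i′ i′<p))))
        (≤-trans (block-end≤start i<i′) (proj₁ (proj₁ (js-in-block i′<p))))

    js-in-interval : ∀ i → i < p → HasLevelIn m a b (js i)
    js-in-interval i i<p =
      let (start≤js , js<end) , atLevel = js-in-block i<p in
      (≤-trans (m≤m+n a (i * q)) start≤js , <-≤-trans js<end (block-end≤b i<p)) , atLevel

  no-long-interval-step : ∀ {L} → NoLongInterval L → NoLongInterval (suc L)
  no-long-interval-step noLong {m} {a} {b} within b≤N long
    with long-run noLong within b≤N long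
  ... | js , increasing , inRun
    with interrupted m js increasing (λ i i<p → proj₂ (inRun i i<p))
  ... | j , after , before , level<m = <⇒≱ level<m (proj₁ (within j (a≤j , j<b)))
    where
    a≤j : a ≤ toℕ j
    a≤j = ≤-trans (proj₁ (proj₁ (inRun 0 p≥1))) (<⇒≤ after)
    j<b : toℕ j < b
    j<b = <-trans before (proj₂ (proj₁ (inRun (p ∸ 1) (∸-monoʳ-< z<s p≥1))))

  no-long-interval : ∀ L → NoLongInterval L
  no-long-interval zero {m} {a} {b} within b≤N a+1≤b =
    let m≤level , level<m+0 = within j (a≤j , j<b) in
    <⇒≱ (subst (level j <_) (+-identityʳ m) level<m+0) m≤level
    where
    a<b : a < b
    a<b = subst (_≤ b) (+-comm a 1) a+1≤b
    j : Fin N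
    j = fromℕ< (<-≤-trans a<b b≤N)
    a≤j : a ≤ toℕ j
    a≤j = ≤-reflexive (sym (toℕ-fromℕ< _))
    j<b : toℕ j < b
    j<b = subst (_< b) (sym (toℕ-fromℕ< _)) a<b
  no-long-interval (suc L) = no-long-interval-step (no-long-interval L)

lemma3p2p1 : (n d k p N : ℕ) → 1 ≤ n → 1 ≤ d → 2 ≤ k → IsPnd n d p →
    (S : Fin N → Word (k ∸ 1)) →
    (∀ j → ExactlyOneOne (S j)) →
    (∀ (s : Fin (k ∸ 1)) (js : ℕ → Fin N) →
      (∀ i i′ → i < i′ → i′ < p → js i F.< js i′) →
      (∀ i → i < p → OneAt (S (js i)) s) →
      ∃ λ j → (js 0 F.< j) × (j F.< js (p ∸ 1)) × ∃ λ t → (t F.< s) × OneAt (S j) t) →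
    N ≤ p ^ (k ∸ 1) ∸ 1
lemma3p2p1 n d k p N n≥1 d≥1 _ isP S one H = ∸-monoˡ-≤ 1 (≰⇒> short)
  where
  p≥1 : 1 ≤ p
  p≥1 = pnd-positive n≥1 d≥1 isP

  position : Fin N → Fin (k ∸ 1)
  position j = proj₁ (one j)

  level : Fin N → ℕ
  level j = toℕ (position j)

  interrupted : RunsInterrupted level p
  interrupted m js increasing atLevel
    with H (position (js 0)) js increasing oneAtStart
    where
    oneAtStart : ∀ i → i < p → OneAt (S (js i)) (position (js 0))
    oneAtStart i i<p = subst (OneAt (S (js i)))
      (toℕ-injective (trans (atLevel i i<p) (sym (atLevel 0 p≥1))))
      (proj₁ (proj₂ (one (js i))))
  ... | j , after , before , t , t<s , oneAtT =
    j , after , before ,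
    subst (_< m) (cong toℕ (oneAt-unique {w = S j} (one j) oneAtT))
      (subst (toℕ t <_) (atLevel 0 p≥1) t<s)

  open Interrupted level p≥1 interrupted

  short : ¬ (p ^ (k ∸ 1) ≤ N)
  short = no-long-interval (k ∸ 1) (λ j _ → z≤n , toℕ<n (position j)) ≤-refl
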